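{- Let $\Gamma$ be a finite simple connected tetravalent graph admitting a self-reverse distance magic labeling $\ell$. If $\ell$ is degenerate, then for each vertex $v$ of $\Gamma$ the vertices $v$ and $v^\ell$ are distinct and have the same neighborhoods. Consequently, $\Gamma$ has even order and is a wreath graph $\mathrm{W}(m)$ for some $m\ge 3$.
   Context: For a positive integer $n$, $\mathcal{I}_n=\{1-n,3-n,\ldots,n-1\}$. For a regular graph $\Gamma$ of order $n$, a distance magic labeling is a bijection $\ell\colon V(\Gamma)\to\mathcal{I}_n$ such that for every vertex the sum of the labels of its neighbors equals $0$. For $v\in V(\Gamma)$, $v^\ell$ is the unique vertex with $\ell(v)+\ell(v^\ell)=0$; $\ell$ is self-reverse if for all vertices $u,v$: $u\sim v$ if and only if $u^\ell\sim v^\ell$. A distance magic labeling $\ell$ of a tetravalent graph is degenerate if there exist vertices $u,v$ with $u\ne u^\ell$, $v\ne v^\ell$ such that $u$ is adjacent to both $v$ and $v^\ell$. For $m\ge3$, the wreath graph $\mathrm{W}(m)$ has vertex set $\{x_i,y_i\colon i\in\mathbb{Z}_m\}$, where for each $i\in\mathbb{Z}_m$ each of $x_i,y_i$ is adjacent to each of $x_{i-1},y_{i-1},x_{i+1},y_{i+1}$ (indices mod $m$). -}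

module Defs where

open import Data.Nat as ℕ using (ℕ; zero; suc; _<_; _≤_)
open import Data.Integer as ℤ using (ℤ; +_; 0ℤ)
open import Data.Fin using (Fin; toℕ)
open import Data.Bool using (Bool; true; false; if_then_else_)
open import Data.List using (List; map)
open import Data.Nat.ListAction using (sum)
open import Data.Product using (Σ; ∃; _×_; _,_)
open import Data.Sum using (_⊎_)
open import Relation.Binary.PropositionalEquality using (_≡_; _≢_)
open import Function.Definitions using (Injective; Bijective)
open import Function.Bundles using (_⇔_)

allFin : (n : ℕ) → List (Fin n)
allFin n = Data.List.tabulate (λ i → i)
  where import Data.List

record Graph : Set where
  field
    n      : ℕ
    adj    : Fin n → Fin n → Bool
    sym    : ∀ u v → adj u v ≡ adj v u
    irrefl : ∀ v → adj v v ≡ false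
open Graph public

degree : (G : Graph) → Fin (n G) → ℕ
degree G v = sum (map (λ u → if adj G v u then 1 else 0) (allFin (n G)))

Tetravalent : Graph → Set
Tetravalent G = ∀ v → degree G v ≡ 4

data Reach (G : Graph) : Fin (n G) → Fin (n G) → Set where
  here : ∀ {u} → Reach G u u
  step : ∀ {u w v} → adj G u w ≡ true → Reach G w v → Reach G u v

Connected : Graph → Set
Connected G = ∀ u v → Reach G u v

InI : ℕ → ℤ → Set
InI n z = Σ ℕ λ k → k < n × z ≡ (+ (2 ℕ.* k ℕ.+ 1)) ℤ.- (+ n)

neighbourSum : (G : Graph) → (Fin (n G) → ℤ) → Fin (n G) → ℤ
neighbourSum G ℓ v =
  Data.List.foldr ℤ._+_ 0ℤ (map (λ u → if adj G v u then ℓ u else 0ℤ) (allFin (n G)))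
  where import Data.List

record DistanceMagicLabeling (G : Graph) (ℓ : Fin (n G) → ℤ) : Set where
  field
    injective  : Injective _≡_ _≡_ ℓ
    intoI      : ∀ v → InI (n G) (ℓ v)
    ontoI      : ∀ z → InI (n G) z → ∃ λ v → ℓ v ≡ z
    magic      : ∀ v → neighbourSum G ℓ v ≡ 0ℤ

-- Rev ℓ u w  means  w = u^ℓ  (i.e. ℓ(u) + ℓ(w) = 0)
Rev : {G : Graph} → (Fin (n G) → ℤ) → Fin (n G) → Fin (n G) → Set
Rev ℓ u w = ℓ u ℤ.+ ℓ w ≡ 0ℤ

SelfReverse : (G : Graph) → (Fin (n G) → ℤ) → Set
SelfReverse G ℓ = ∀ u v u' v' → Rev {G} ℓ u u' → Rev {G} ℓ v v' →
  (adj G u v ≡ true ⇔ adj G u' v' ≡ true)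

Degenerate : (G : Graph) → (Fin (n G) → ℤ) → Set
Degenerate G ℓ = Σ (Fin (n G)) λ u → Σ (Fin (n G)) λ u' →
  Σ (Fin (n G)) λ v → Σ (Fin (n G)) λ v' →
  Rev {G} ℓ u u' × u ≢ u' × Rev {G} ℓ v v' × v ≢ v' ×
  adj G u v ≡ true × adj G u v' ≡ true

-- Wreath graph W(m): vertex (i , false) is x_i, (i , true) is y_i.
-- NextMod m i j : j = i + 1 (mod m)
NextMod : (m : ℕ) → Fin m → Fin m → Set
NextMod m i j = suc (toℕ i) ≡ toℕ j ⊎ (suc (toℕ i) ≡ m × toℕ j ≡ 0)

WAdj : (m : ℕ) → Fin m × Bool → Fin m × Bool → Set
WAdj m (i , a) (j , b) = NextMod m i j ⊎ NextMod m j i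

IsoToWreath : (G : Graph) → ℕ → Set
IsoToWreath G m = Σ (Fin (n G) → Fin m × Bool) λ φ →
  Bijective _≡_ _≡_ φ × (∀ u v → (adj G u v ≡ true ⇔ WAdj m (φ u) (φ v)))

-- In a tetravalent distance magic graph every neighbourhood has label sum 0.  If N(w) contains a
-- pair {x, x^ℓ} with x ≠ x^ℓ, the remaining two labels also sum to 0, so N(w) = {x, x^ℓ, p, p^ℓ}
-- is a union of two ℓ-pairs.  Self-reversality carries this from w to every neighbour y (which is
-- then adjacent to both w and w^ℓ), so by connectivity it holds at every vertex, and then
-- N(v) = N(v^ℓ).  Contracting the pairs {v, v^ℓ} leaves a connected 2-regular graph: a walk
-- s₀ s₁ s₂ … that never turns back into the pair it came from first returns to the pair of s₀,
-- after m ≥ 3 steps, and (i, b) ↦ s_i or s_i^ℓ is an isomorphism W(m) ≅ Γ; in particular |V| = 2m.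
module Submission where

open import Defs hiding (sym)
open import Data.Nat using (ℕ; zero; suc; pred; _+_; _*_; _≤_; _<_; s≤s; z≤n; >-nonZero)
import Data.Nat.Properties as ℕ
open import Data.Nat.Induction using (<-rec)
open import Data.Nat.ListAction using (sum)
open import Data.Integer as ℤ using (ℤ; +_; 0ℤ; -_)
import Data.Integer.Properties as ℤ
open import Data.Integer.Tactic.RingSolver using (solve-∀)
open import Algebra.Bundles using (AbelianGroup)
open import Algebra.Properties.Group (AbelianGroup.group ℤ.+-0-abelianGroup) using (inverseʳ-unique)
open import Data.Fin using (Fin; toℕ; fromℕ<) renaming (_≟_ to _≟ᶠ_)
open import Data.Fin.Properties using (cantor-schröder-bernstein; *↔×; 2↔Bool; pigeonhole; toℕ-injective; toℕ<n; toℕ-fromℕ<)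
open import Data.Bool using (Bool; true; false; if_then_else_)
open import Data.Bool.Properties using (T-≡)
open import Data.Product using (Σ; ∃; ∃₂; _×_; _,_; proj₁; proj₂)
open import Data.Product.Function.NonDependent.Propositional using (_×-↔_)
open import Data.Sum using (_⊎_; inj₁; inj₂)
open import Data.List using (List; []; _∷_; _++_; map; foldr; length; filterᵇ)
open import Data.List.Membership.Propositional using (_∈_)
open import Data.List.Membership.Propositional.Properties using (∈-∃++; ∈-allFin; ∈-filter⁺; ∈-filter⁻)
open import Data.List.Relation.Unary.Any as Any using (here; there)
open import Data.List.Relation.Unary.All using ([]; _∷_)
open import Data.List.Relation.Unary.AllPairs using ([]; _∷_)
open import Data.List.Relation.Unary.Unique.Propositional using (Unique)
import Data.List.Relation.Unary.Unique.Propositional.Properties as Unique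
open import Data.List.Relation.Binary.Permutation.Propositional using (_↭_; ↭-sym; ↭-trans; ↭-prep; ↭⇒↭ₛ)
open import Data.List.Relation.Binary.Permutation.Propositional.Properties using (shift; ∈-resp-↭; ↭-length; map⁺)
import Data.List.Relation.Binary.Permutation.Setoid.Properties as Permutationₛ
open import Function using (_∘_; _⇔_; mk⇔; Equivalence; _↔_; Injection; mk↔ₛ′; Bijection)
open import Function.Properties.Equivalence using () renaming (trans to ⇔-trans)
open import Function.Properties.Inverse using (↔-refl; ↔-sym; ↔-trans; Inverse⇒Injection; Inverse⇒Bijection)
open import Relation.Nullary using (¬_; Dec; yes; no; contradiction)
open import Relation.Nullary.Decidable using (T?; _⊎-dec_)
open import Relation.Unary using (Decidable)
open import Relation.Binary.Definitions using (tri<; tri≈; tri>)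
open import Relation.Binary.PropositionalEquality

module _ {A : Set} where

  ∈⇒↭∷ : ∀ {x : A} {xs} → x ∈ xs → ∃ λ ys → xs ↭ x ∷ ys
  ∈⇒↭∷ {x} x∈xs with ys , zs , refl ← ∈-∃++ x∈xs = ys ++ zs , shift x ys zs

  ↭-two-more : ∀ {xs} {x y : A} zs → xs ↭ x ∷ y ∷ zs → length xs ≡ 4 →
               ∃₂ λ a b → xs ↭ x ∷ y ∷ a ∷ b ∷ []
  ↭-two-more (a ∷ b ∷ []) p _ = a , b , p
  ↭-two-more [] p len with () ← trans (sym (↭-length p)) len
  ↭-two-more (_ ∷ []) p len with () ← trans (sym (↭-length p)) len
  ↭-two-more (_ ∷ _ ∷ _ ∷ _) p len with () ← trans (sym (↭-length p)) len

  split-off-pair : ∀ {x y : A} {xs} → length xs ≡ 4 → x ∈ xs → y ∈ xs → x ≢ y →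
                   ∃₂ λ a b → xs ↭ x ∷ y ∷ a ∷ b ∷ []
  split-off-pair {x} len x∈xs y∈xs x≢y
    with ys , xs↭x∷ys ← ∈⇒↭∷ x∈xs
    with zs , ys↭y∷zs ← ∈⇒↭∷ (Any.tail (x≢y ∘ sym) (∈-resp-↭ xs↭x∷ys y∈xs))
    = ↭-two-more zs (↭-trans xs↭x∷ys (↭-prep x ys↭y∷zs)) len

  labelSum : (A → ℤ) → List A → ℤ
  labelSum ℓ xs = foldr ℤ._+_ 0ℤ (map ℓ xs)

  labelSum-resp-↭ : ∀ (ℓ : A → ℤ) {xs ys} → xs ↭ ys → labelSum ℓ xs ≡ labelSum ℓ ys
  labelSum-resp-↭ ℓ p =
    Permutationₛ.foldr-commMonoid (setoid ℤ) ℤ.+-0-isCommutativeMonoid (↭⇒↭ₛ (map⁺ ℓ p))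

  labelSum-filterᵇ : ∀ (ℓ : A → ℤ) p xs →
    labelSum ℓ (filterᵇ p xs) ≡ foldr ℤ._+_ 0ℤ (map (λ u → if p u then ℓ u else 0ℤ) xs)
  labelSum-filterᵇ ℓ p [] = refl
  labelSum-filterᵇ ℓ p (u ∷ us) with p u
  ... | true = cong (ℤ._+_ (ℓ u)) (labelSum-filterᵇ ℓ p us)
  ... | false = trans (labelSum-filterᵇ ℓ p us) (sym (ℤ.+-identityˡ _))

  length-filterᵇ : ∀ p (xs : List A) →
    length (filterᵇ p xs) ≡ sum (map (λ u → if p u then 1 else 0) xs)
  length-filterᵇ p [] = refl
  length-filterᵇ p (u ∷ us) with p u
  ... | true = cong suc (length-filterᵇ p us)
  ... | false = length-filterᵇ p us

cancel-pair : ∀ a b c d → a ℤ.+ b ≡ 0ℤ → a ℤ.+ (b ℤ.+ (c ℤ.+ (d ℤ.+ 0ℤ))) ≡ 0ℤ → c ℤ.+ d ≡ 0ℤ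
cancel-pair a b c d a+b≡0 sum≡0 = begin
  c ℤ.+ d                            ≡⟨ ℤ.+-identityˡ (c ℤ.+ d) ⟨
  0ℤ ℤ.+ (c ℤ.+ d)                   ≡⟨ cong (ℤ._+ (c ℤ.+ d)) a+b≡0 ⟨
  (a ℤ.+ b) ℤ.+ (c ℤ.+ d)            ≡⟨ reassociate a b c d ⟩
  a ℤ.+ (b ℤ.+ (c ℤ.+ (d ℤ.+ 0ℤ)))   ≡⟨ sum≡0 ⟩
  0ℤ                                 ∎
  where
  open ≡-Reasoning
  reassociate : ∀ a b c d → (a ℤ.+ b) ℤ.+ (c ℤ.+ d) ≡ a ℤ.+ (b ℤ.+ (c ℤ.+ (d ℤ.+ 0ℤ)))
  reassociate = solve-∀

true-iff⇒≡ : ∀ {a b : Bool} → (a ≡ true → b ≡ true) → (b ≡ true → a ≡ true) → a ≡ b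
true-iff⇒≡ {false} {false} _ _ = refl
true-iff⇒≡ {false} {true}  _ b⇒a = b⇒a refl
true-iff⇒≡ {true}  {false} a⇒b _ = sym (a⇒b refl)
true-iff⇒≡ {true}  {true}  _ _ = refl

Least : (ℕ → Set) → Set
Least P = ∃ λ k → P k × (∀ {i} → i < k → ¬ P i)

least : ∀ {P : ℕ → Set} → Decidable P → ∀ {j} → P j → Least P
least {P} P? {j} = <-rec (λ j → P j → Least P) search j
  where
  search : ∀ j → (∀ {i} → i < j → P i → Least P) → P j → Least P
  search j below pj with ℕ.anyUpTo? P? j
  ... | yes (i , i<j , pi) = below i<j pi
  ... | no none = j , pj , λ i<j pi → none (_ , i<j , pi)

Fin-↔⇒≡ : ∀ {m n} → Fin m ↔ Fin n → m ≡ n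
Fin-↔⇒≡ m↔n = cantor-schröder-bernstein
  (Injection.injective (Inverse⇒Injection m↔n))
  (Injection.injective (Inverse⇒Injection (↔-sym m↔n)))

×Bool↔*2 : ∀ {m} → (Fin m × Bool) ↔ Fin (m * 2)
×Bool↔*2 = ↔-sym (↔-trans *↔× (↔-refl ×-↔ 2↔Bool))

InI-neg : ∀ {n z} → InI n z → InI n (- z)
InI-neg (k , k<n , refl) with k' , refl ← ℕ.m≤n⇒∃[o]m+o≡n k<n =
  k' , s≤s (ℕ.m≤n+m k' k) , reflect-around-centre
  where
  open ≡-Reasoning
  reflect-around-centre :
    - (+ (2 * k + 1) ℤ.- + (suc k + k')) ≡ + (2 * k' + 1) ℤ.- + (suc k + k')
  reflect-around-centre = begin
    - (+ (2 * k + 1) ℤ.- + (suc k + k'))               ≡⟨ cong₂ (λ a b → - (a ℤ.- b)) (odd k) centre ⟩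
    - ((+ 2 ℤ.* + k ℤ.+ + 1) ℤ.- (+ 1 ℤ.+ + k ℤ.+ + k'))   ≡⟨ swap-roles (+ k) (+ k') ⟩
    (+ 2 ℤ.* + k' ℤ.+ + 1) ℤ.- (+ 1 ℤ.+ + k ℤ.+ + k')     ≡⟨ cong₂ ℤ._-_ (odd k') centre ⟨
    + (2 * k' + 1) ℤ.- + (suc k + k')                  ∎
    where
    odd : ∀ j → + (2 * j + 1) ≡ + 2 ℤ.* + j ℤ.+ + 1
    odd j = trans (ℤ.pos-+ (2 * j) 1) (cong (ℤ._+ + 1) (ℤ.pos-* 2 j))
    centre : + (suc k + k') ≡ + 1 ℤ.+ + k ℤ.+ + k'
    centre = trans (ℤ.pos-+ (suc k) k') (cong (ℤ._+ + k') (ℤ.pos-+ 1 k))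
    swap-roles : ∀ a b →
      - ((+ 2 ℤ.* a ℤ.+ + 1) ℤ.- (+ 1 ℤ.+ a ℤ.+ b)) ≡ (+ 2 ℤ.* b ℤ.+ + 1) ℤ.- (+ 1 ℤ.+ a ℤ.+ b)
    swap-roles = solve-∀

module Reversal {G : Graph} {ℓ : Fin (n G) → ℤ} (dml : DistanceMagicLabeling G ℓ) where
  open DistanceMagicLabeling dml

  opaque
    rev : Fin (n G) → Fin (n G)
    rev v = proj₁ (ontoI (- ℓ v) (InI-neg (intoI v)))

    ℓ-rev : ∀ v → ℓ (rev v) ≡ - ℓ v
    ℓ-rev v = proj₂ (ontoI (- ℓ v) (InI-neg (intoI v)))

  Rev-rev : ∀ v → Rev {G} ℓ v (rev v)
  Rev-rev v = trans (cong (ℤ._+_ (ℓ v)) (ℓ-rev v)) (ℤ.+-inverseʳ (ℓ v))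

  Rev⇒≡rev : ∀ {v w} → Rev {G} ℓ v w → w ≡ rev v
  Rev⇒≡rev {v} {w} r = injective (trans (inverseʳ-unique (ℓ v) (ℓ w) r) (sym (ℓ-rev v)))

  rev-involutive : ∀ v → rev (rev v) ≡ v
  rev-involutive v = sym (Rev⇒≡rev (trans (ℤ.+-comm (ℓ (rev v)) (ℓ v)) (Rev-rev v)))

  SamePair : Fin (n G) → Fin (n G) → Set
  SamePair a b = a ≡ b ⊎ a ≡ rev b

  SamePair-sym : ∀ {a b} → SamePair a b → SamePair b a
  SamePair-sym (inj₁ refl) = inj₁ refl
  SamePair-sym {b = b} (inj₂ refl) = inj₂ (sym (rev-involutive b))

  SamePair-trans : ∀ {a b c} → SamePair a b → SamePair b c → SamePair a c
  SamePair-trans (inj₁ refl) b≈c = b≈c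
  SamePair-trans (inj₂ refl) (inj₁ refl) = inj₂ refl
  SamePair-trans (inj₂ refl) (inj₂ refl) = inj₁ (rev-involutive _)

  samePair? : ∀ a b → Dec (SamePair a b)
  samePair? a b = (a ≟ᶠ b) ⊎-dec (a ≟ᶠ rev b)

nbhd : (G : Graph) → Fin (n G) → List (Fin (n G))
nbhd G w = filterᵇ (adj G w) (allFin (n G))

module _ (G : Graph) {w z : Fin (n G)} where

  ∈-nbhd⁺ : adj G w z ≡ true → z ∈ nbhd G w
  ∈-nbhd⁺ wz = ∈-filter⁺ (T? ∘ adj G w) (∈-allFin z) (Equivalence.from T-≡ wz)

  ∈-nbhd⁻ : z ∈ nbhd G w → adj G w z ≡ true
  ∈-nbhd⁻ z∈ = Equivalence.to T-≡ (proj₂ (∈-filter⁻ (T? ∘ adj G w) {xs = allFin (n G)} z∈))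

nbhd-unique : ∀ G w → Unique (nbhd G w)
nbhd-unique G w = Unique.filter⁺ (T? ∘ adj G w) {allFin (n G)} (Unique.allFin⁺ (n G))

length-nbhd : ∀ G w → length (nbhd G w) ≡ degree G w
length-nbhd G w = length-filterᵇ (adj G w) (allFin (n G))

labelSum-nbhd : ∀ G ℓ w → labelSum ℓ (nbhd G w) ≡ neighbourSum G ℓ w
labelSum-nbhd G ℓ w = labelSum-filterᵇ ℓ (adj G w) (allFin (n G))

module PairedNeighbourhoods (G : Graph) (tet : Tetravalent G) {ℓ : Fin (n G) → ℤ}
  (dml : DistanceMagicLabeling G ℓ) where
  open DistanceMagicLabeling dml using (magic)
  open Reversal dml public

  V : Set
  V = Fin (n G)

  infix 4 _~_
  _~_ : V → V → Set
  u ~ v = adj G u v ≡ true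

  ~-sym : ∀ {u v} → u ~ v → v ~ u
  ~-sym {u} {v} uv = trans (Graph.sym G v u) uv

  pair-closed : ∀ {w x z} → w ~ x → w ~ rev x → SamePair z x → w ~ rev z
  pair-closed _ wx' (inj₁ refl) = wx'
  pair-closed wx _ (inj₂ refl) = subst (_ ~_) (sym (rev-involutive _)) wx

  pair-nonfixed : ∀ {x z} → x ≢ rev x → SamePair z x → z ≢ rev z
  pair-nonfixed x≢x' (inj₁ refl) = x≢x'
  pair-nonfixed {x} x≢x' (inj₂ refl) x'≡x'' = x≢x' (sym (trans x'≡x'' (rev-involutive x)))

  record PairedNeighbourhood (w x : V) : Set where
    field
      other : V
      ~other : w ~ other
      ~rev-other : w ~ rev other
      other-unpaired : ¬ SamePair other x
      other≢rev : other ≢ rev other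
      neighbour-pairs : ∀ {z} → w ~ z → SamePair z x ⊎ SamePair z other

  opaque
    paired-neighbourhood : ∀ {w x} → w ~ x → w ~ rev x → x ≢ rev x → PairedNeighbourhood w x
    paired-neighbourhood {w} {x} wx wx' x≢x'
      with a , b , nbhd↭ ← split-off-pair (trans (length-nbhd G w) (tet w))
                                          (∈-nbhd⁺ G wx) (∈-nbhd⁺ G wx') x≢x'
      with (_ ∷ x≢a ∷ _) ∷ (x'≢a ∷ _) ∷ (a≢b ∷ []) ∷ _
             ← Permutationₛ.Unique-resp-↭ (setoid V) (↭⇒↭ₛ nbhd↭) (nbhd-unique G w)
      = record
        { other = a
        ; ~other = ∈-nbhd⁻ G (∈-resp-↭ (↭-sym nbhd↭) (there (there (here refl))))
        ; ~rev-other = subst (w ~_) b≡a'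
                         (∈-nbhd⁻ G (∈-resp-↭ (↭-sym nbhd↭) (there (there (there (here refl))))))
        ; other-unpaired = λ { (inj₁ a≡x) → x≢a (sym a≡x)
                             ; (inj₂ a≡x') → x'≢a (sym a≡x') }
        ; other≢rev = λ a≡a' → a≢b (trans a≡a' (sym b≡a'))
        ; neighbour-pairs = λ wz → classify (∈-resp-↭ nbhd↭ (∈-nbhd⁺ G wz))
        }
      where
      b≡a' : b ≡ rev a
      b≡a' = Rev⇒≡rev (cancel-pair (ℓ x) (ℓ (rev x)) (ℓ a) (ℓ b) (Rev-rev x)
               (trans (labelSum-resp-↭ ℓ (↭-sym nbhd↭)) (trans (labelSum-nbhd G ℓ w) (magic w))))
      classify : ∀ {z} → z ∈ x ∷ rev x ∷ a ∷ b ∷ [] → SamePair z x ⊎ SamePair z a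
      classify (here z≡x) = inj₁ (inj₁ z≡x)
      classify (there (here z≡x')) = inj₁ (inj₂ z≡x')
      classify (there (there (here z≡a))) = inj₂ (inj₁ z≡a)
      classify (there (there (there (here z≡b)))) = inj₂ (inj₂ (trans z≡b b≡a'))

module DegenerateLabelling (G : Graph) (tet : Tetravalent G) {ℓ : Fin (n G) → ℤ}
  (dml : DistanceMagicLabeling G ℓ) (sr : SelfReverse G ℓ) where
  open PairedNeighbourhoods G tet dml public

  ~-rev : ∀ {u v} → u ~ v → rev u ~ rev v
  ~-rev {u} {v} = Equivalence.to (sr u v (rev u) (rev v) (Rev-rev u) (Rev-rev v))

  record DegenerateAt (w : V) : Set where
    field
      nonfixed : w ≢ rev w
      pivot : V
      pivot-nonfixed : pivot ≢ rev pivot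
      ~pivot : w ~ pivot
      ~rev-pivot : w ~ rev pivot

    paired : PairedNeighbourhood w pivot
    paired = paired-neighbourhood ~pivot ~rev-pivot pivot-nonfixed

    open PairedNeighbourhood paired

    rev-closed : ∀ {z} → w ~ z → w ~ rev z
    rev-closed wz with neighbour-pairs wz
    ... | inj₁ z≈pivot = pair-closed ~pivot ~rev-pivot z≈pivot
    ... | inj₂ z≈other = pair-closed ~other ~rev-other z≈other

    neighbour-nonfixed : ∀ {z} → w ~ z → z ≢ rev z
    neighbour-nonfixed wz with neighbour-pairs wz
    ... | inj₁ z≈pivot = pair-nonfixed pivot-nonfixed z≈pivot
    ... | inj₂ z≈other = pair-nonfixed other≢rev z≈other

    twins : ∀ x → adj G w x ≡ adj G (rev w) x
    twins x = true-iff⇒≡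
      (λ wx → subst (rev w ~_) (rev-involutive x) (~-rev (rev-closed wx)))
      (λ w'x → subst (w ~_) (rev-involutive x)
                 (rev-closed (subst (_~ rev x) (rev-involutive w) (~-rev w'x))))

  open DegenerateAt

  degenerateAt-~ : ∀ {w y} → DegenerateAt w → w ~ y → DegenerateAt y
  degenerateAt-~ {w} {y} d wy = record
    { nonfixed = neighbour-nonfixed d wy
    ; pivot = w
    ; pivot-nonfixed = nonfixed d
    ; ~pivot = ~-sym wy
    ; ~rev-pivot = ~-sym (subst (rev w ~_) (rev-involutive y) (~-rev (rev-closed d wy)))
    }

  degenerateAt-reach : ∀ {u v} → DegenerateAt u → Reach G u v → DegenerateAt v
  degenerateAt-reach d here = d
  degenerateAt-reach d (step uw wv) = degenerateAt-reach (degenerateAt-~ d uw) wv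

  degenerate⇒degenerateAt : Degenerate G ℓ → ∃ DegenerateAt
  degenerate⇒degenerateAt (u , u' , v , v' , Ruu' , u≢u' , Rvv' , v≢v' , uv , uv') = u , record
    { nonfixed = λ u≡u' → u≢u' (trans u≡u' (sym (Rev⇒≡rev Ruu')))
    ; pivot = v
    ; pivot-nonfixed = λ v≡v' → v≢v' (trans v≡v' (sym (Rev⇒≡rev Rvv')))
    ; ~pivot = uv
    ; ~rev-pivot = subst (u ~_) (Rev⇒≡rev Rvv') uv'
    }

  degenerate-everywhere : Connected G → Degenerate G ℓ → ∀ v → DegenerateAt v
  degenerate-everywhere conn degen v with u , d ← degenerate⇒degenerateAt degen =
    degenerateAt-reach d (conn u v)

  module Wreath (conn : Connected G) (degenerate : ∀ v → DegenerateAt v) where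

    adj-resp-SamePairˡ : ∀ {a a'} b → SamePair a a' → adj G a b ≡ adj G a' b
    adj-resp-SamePairˡ b (inj₁ refl) = refl
    adj-resp-SamePairˡ b (inj₂ refl) = sym (twins (degenerate _) b)

    adj-resp-SamePair : ∀ {a a' b b'} → SamePair a a' → SamePair b b' → adj G a b ≡ adj G a' b'
    adj-resp-SamePair {a} {a'} {b} {b'} a≈a' b≈b' = begin
      adj G a b    ≡⟨ adj-resp-SamePairˡ b a≈a' ⟩
      adj G a' b   ≡⟨ Graph.sym G a' b ⟩
      adj G b a'   ≡⟨ adj-resp-SamePairˡ a' b≈b' ⟩
      adj G b' a'  ≡⟨ Graph.sym G b' a' ⟩
      adj G a' b'  ∎
      where open ≡-Reasoning

    ~-resp-SamePair : ∀ {a a' b b'} → SamePair a a' → SamePair b b' → a ~ b → a' ~ b'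
    ~-resp-SamePair a≈a' b≈b' ab = trans (sym (adj-resp-SamePair a≈a' b≈b')) ab

    ~⇒¬SamePair : ∀ {a b} → a ~ b → ¬ SamePair a b
    ~⇒¬SamePair {a} {b} ab a≈b
      with () ← trans (sym ab) (trans (adj-resp-SamePairˡ b a≈b) (Graph.irrefl G b))

    ~⇒paired : ∀ {w a} → w ~ a → PairedNeighbourhood w a
    ~⇒paired wa = paired-neighbourhood wa (rev-closed (degenerate _) wa) (nonfixed (degenerate _))

    two-pairs : ∀ {w a b z} → w ~ a → w ~ b → ¬ SamePair a b → w ~ z → SamePair z a ⊎ SamePair z b
    two-pairs wa wb a≉b wz with neighbour-pairs wb | neighbour-pairs wz
      where open PairedNeighbourhood (~⇒paired wa)
    ... | inj₁ b≈a | _ = contradiction (SamePair-sym b≈a) a≉b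
    ... | inj₂ _ | inj₁ z≈a = inj₁ z≈a
    ... | inj₂ b≈p | inj₂ z≈p = inj₂ (SamePair-trans z≈p (SamePair-sym b≈p))

    module Walk {v₀ v₁ : V} (v₀~v₁ : v₀ ~ v₁) where

      record Arc : Set where
        constructor arc
        field
          {tail head} : V
          edge : tail ~ head

      advance : Arc → Arc
      advance (arc e) = arc (PairedNeighbourhood.~other (~⇒paired (~-sym e)))

      walk : ℕ → Arc
      walk zero = arc v₀~v₁
      walk (suc k) = advance (walk k)

      s : ℕ → V
      s k = Arc.tail (walk k)

      s-~ : ∀ k → s k ~ s (suc k)
      s-~ k = Arc.edge (walk k)

      turn : ∀ k → PairedNeighbourhood (s (suc k)) (s k)
      turn k = ~⇒paired (~-sym (s-~ k))

      s-step : ∀ k → ¬ SamePair (s k) (s (suc k))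
      s-step k = ~⇒¬SamePair (s-~ k)

      s-turn : ∀ k → ¬ SamePair (s k) (s (2 + k))
      s-turn k = PairedNeighbourhood.other-unpaired (turn k) ∘ SamePair-sym

      s-neighbours : ∀ k {z} → s (suc k) ~ z → SamePair z (s k) ⊎ SamePair z (s (2 + k))
      s-neighbours k = PairedNeighbourhood.neighbour-pairs (turn k)

      Repeats : ℕ → Set
      Repeats j = ∃ λ i → i < j × SamePair (s i) (s j)

      repeats? : Decidable Repeats
      repeats? j = ℕ.anyUpTo? (λ i → samePair? (s i) (s j)) j

      some-repeat : ∃ Repeats
      some-repeat with i , j , i<j , sᵢ≡sⱼ ← pigeonhole (ℕ.n<1+n (n G)) (s ∘ toℕ) =
        toℕ j , toℕ i , i<j , inj₁ sᵢ≡sⱼ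

      -- s (j + 1) ≈ s (i + 1) makes s j a neighbour of s (i + 1), hence paired with s i or
      -- s (i + 2): an earlier repetition, unless j = i + 1 or j = i + 2, which the walk excludes.
      first-repeat-from-start : ∀ {i j} → (∀ {k} → k < j → ¬ Repeats k) →
                                i < j → SamePair (s i) (s j) → i ≡ 0
      first-repeat-from-start {zero} _ _ _ = refl
      first-repeat-from-start {suc i} {suc j} earlier (s≤s i<j) sᵢ₊₁≈sⱼ₊₁
        with s-neighbours i (~-resp-SamePair (SamePair-sym sᵢ₊₁≈sⱼ₊₁) (inj₁ refl) (~-sym (s-~ j)))
      ... | inj₁ sⱼ≈sᵢ = contradiction (i , i<j , SamePair-sym sⱼ≈sᵢ) (earlier ℕ.≤-refl)
      ... | inj₂ sⱼ≈sᵢ₊₂ with ℕ.<-cmp (2 + i) j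
      ...   | tri< i+2<j _ _ = contradiction (2 + i , i+2<j , SamePair-sym sⱼ≈sᵢ₊₂) (earlier ℕ.≤-refl)
      ...   | tri≈ _ refl _ = contradiction sᵢ₊₁≈sⱼ₊₁ (s-turn (suc i))
      ...   | tri> _ _ j<i+2 with refl ← ℕ.≤-antisym i<j (ℕ.≤-pred j<i+2) =
        contradiction sᵢ₊₁≈sⱼ₊₁ (s-step (suc i))

      record Cycle (m : ℕ) : Set where
        field
          3≤m : 3 ≤ m
          closes : SamePair (s m) (s 0)
          distinct : ∀ {i j} → i < m → j < m → SamePair (s i) (s j) → i ≡ j

      cycle : ∃ Cycle
      cycle with j , (i , i<j , sᵢ≈sⱼ) , earlier ← least repeats? (proj₂ some-repeat)
           with refl ← first-repeat-from-start earlier i<j sᵢ≈sⱼ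
           = j , record { 3≤m = 3≤j j i<j sᵢ≈sⱼ ; closes = SamePair-sym sᵢ≈sⱼ ; distinct = distinct }
        where
        3≤j : ∀ j → 0 < j → SamePair (s 0) (s j) → 3 ≤ j
        3≤j 1 _ s₀≈s₁ = contradiction s₀≈s₁ (s-step 0)
        3≤j 2 _ s₀≈s₂ = contradiction s₀≈s₂ (s-turn 0)
        3≤j (suc (suc (suc _))) _ _ = s≤s (s≤s (s≤s z≤n))
        distinct : ∀ {a b} → a < j → b < j → SamePair (s a) (s b) → a ≡ b
        distinct {a} {b} a<j b<j sa≈sb with ℕ.<-cmp a b
        ... | tri< a<b _ _ = contradiction (a , a<b , sa≈sb) (earlier b<j)
        ... | tri≈ _ a≡b _ = a≡b
        ... | tri> _ _ b<a = contradiction (b , b<a , SamePair-sym sa≈sb) (earlier a<j)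

      module OnCycle {m : ℕ} (C : Cycle m) where
        open Cycle C

        -- Next (toℕ i) (toℕ j) is NextMod m i j, so Consecutive on indices is WAdj on Fin m.
        Next : ℕ → ℕ → Set
        Next i j = suc i ≡ j ⊎ (suc i ≡ m × j ≡ 0)

        Consecutive : ℕ → ℕ → Set
        Consecutive i j = Next i j ⊎ Next j i

        1<m : 1 < m
        1<m = ℕ.≤-trans (s≤s (s≤s z≤n)) 3≤m

        last : ℕ
        last = pred m

        suc-last : suc last ≡ m
        suc-last = ℕ.suc-pred m {{>-nonZero (ℕ.<-trans (s≤s z≤n) 1<m)}}

        s₀~s-last : s 0 ~ s last
        s₀~s-last = ~-sym (~-resp-SamePair (inj₁ refl) s-last+1≈s₀ (s-~ last))
          where
          s-last+1≈s₀ : SamePair (s (suc last)) (s 0)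
          s-last+1≈s₀ = subst (λ t → SamePair (s t) (s 0)) (sym suc-last) closes

        s₁≉s-last : ¬ SamePair (s 1) (s last)
        s₁≉s-last s₁≈s-last = 3≰2 (subst (3 ≤_) (sym 2≡m) 3≤m)
          where
          2≡m : 2 ≡ m
          2≡m = trans (cong suc (distinct 1<m (ℕ.≤-reflexive suc-last) s₁≈s-last)) suc-last
          3≰2 : ¬ 3 ≤ 2
          3≰2 (s≤s (s≤s ()))

        neighbours-on-cycle : ∀ {i y} → i < m → s i ~ y →
                              ∃ λ j → j < m × Consecutive i j × SamePair y (s j)
        neighbours-on-cycle {zero} _ s₀~y with two-pairs (s-~ 0) s₀~s-last s₁≉s-last s₀~y
        ... | inj₁ y≈s₁ = 1 , 1<m , inj₁ (inj₁ refl) , y≈s₁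
        ... | inj₂ y≈s-last = last , ℕ.≤-reflexive suc-last , inj₂ (inj₂ (suc-last , refl)) , y≈s-last
        neighbours-on-cycle {suc i} i+1<m s₁₊ᵢ~y with s-neighbours i s₁₊ᵢ~y
        ... | inj₁ y≈sᵢ = i , ℕ.<-trans (ℕ.n<1+n i) i+1<m , inj₂ (inj₁ refl) , y≈sᵢ
        ... | inj₂ y≈sᵢ₊₂ with ℕ.m≤n⇒m<n∨m≡n i+1<m
        ...   | inj₁ i+2<m = 2 + i , i+2<m , inj₁ (inj₁ refl) , y≈sᵢ₊₂
        ...   | inj₂ refl = 0 , s≤s z≤n , inj₁ (inj₂ (refl , refl)) , SamePair-trans y≈sᵢ₊₂ closes

        s-~-Next : ∀ {i j} → Next i j → s i ~ s j
        s-~-Next {i} (inj₁ refl) = s-~ i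
        s-~-Next {i} (inj₂ (refl , refl)) = ~-resp-SamePair (inj₁ refl) closes (s-~ i)

        ~⇔Consecutive : ∀ {i j} → i < m → j < m → s i ~ s j ⇔ Consecutive i j
        ~⇔Consecutive {i} {j} i<m j<m = mk⇔ to from
          where
          to : s i ~ s j → Consecutive i j
          to sᵢ~sⱼ with k , k<m , i,k-consecutive , sⱼ≈sₖ ← neighbours-on-cycle i<m sᵢ~sⱼ
                   with refl ← distinct j<m k<m sⱼ≈sₖ = i,k-consecutive
          from : Consecutive i j → s i ~ s j
          from (inj₁ i→j) = s-~-Next i→j
          from (inj₂ j→i) = ~-sym (s-~-Next j→i)

        cover-reach : ∀ {u v} → Reach G u v →
                      (∃ λ i → i < m × SamePair u (s i)) → ∃ λ i → i < m × SamePair v (s i)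
        cover-reach here u-covered = u-covered
        cover-reach (step u~w w⇝v) (i , i<m , u≈sᵢ)
          with j , j<m , _ , w≈sⱼ ← neighbours-on-cycle i<m (~-resp-SamePair u≈sᵢ (inj₁ refl) u~w)
          = cover-reach w⇝v (j , j<m , w≈sⱼ)

        cover : ∀ v → ∃ λ i → i < m × SamePair v (s i)
        cover v = cover-reach (conn (s 0) v) (0 , ℕ.<-trans (s≤s z≤n) 1<m , inj₁ refl)

        vertex : Fin m × Bool → V
        vertex (i , false) = s (toℕ i)
        vertex (i , true) = rev (s (toℕ i))

        vertex≈s : ∀ i x → SamePair (vertex (i , x)) (s (toℕ i))
        vertex≈s i false = inj₁ refl
        vertex≈s i true = inj₂ refl

        vertex-injective : ∀ {a b} → vertex a ≡ vertex b → a ≡ b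
        vertex-injective {i , x} {j , y} eq
          with refl ← toℕ-injective (distinct (toℕ<n i) (toℕ<n j)
                        (SamePair-trans (SamePair-sym (vertex≈s i x))
                          (subst (λ v → SamePair v (s (toℕ j))) (sym eq) (vertex≈s j y))))
          = cong (i ,_) (same-side x y eq)
          where
          same-side : ∀ x y → vertex (i , x) ≡ vertex (i , y) → x ≡ y
          same-side false false _ = refl
          same-side false true sᵢ≡sᵢ' = contradiction sᵢ≡sᵢ' (nonfixed (degenerate _))
          same-side true false sᵢ'≡sᵢ = contradiction (sym sᵢ'≡sᵢ) (nonfixed (degenerate _))
          same-side true true _ = refl

        position : V → Fin m × Bool
        position v with cover v
        ... | i , i<m , inj₁ _ = fromℕ< i<m , false
        ... | i , i<m , inj₂ _ = fromℕ< i<m , true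

        vertex∘position : ∀ v → vertex (position v) ≡ v
        vertex∘position v with cover v
        ... | i , i<m , inj₁ v≡sᵢ = trans (cong s (toℕ-fromℕ< i<m)) (sym v≡sᵢ)
        ... | i , i<m , inj₂ v≡sᵢ' = trans (cong (rev ∘ s) (toℕ-fromℕ< i<m)) (sym v≡sᵢ')

        pairs : (Fin m × Bool) ↔ V
        pairs = mk↔ₛ′ vertex position vertex∘position
                  (λ a → vertex-injective (vertex∘position (vertex a)))

        vertex-~⇔WAdj : ∀ a b → vertex a ~ vertex b ⇔ WAdj m a b
        vertex-~⇔WAdj (i , x) (j , y) = ⇔-trans
          (mk⇔ (~-resp-SamePair (vertex≈s i x) (vertex≈s j y))
               (~-resp-SamePair (SamePair-sym (vertex≈s i x)) (SamePair-sym (vertex≈s j y))))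
          (~⇔Consecutive (toℕ<n i) (toℕ<n j))

        isoToWreath : IsoToWreath G m
        isoToWreath = position , Bijection.bijective (Inverse⇒Bijection (↔-sym pairs)) ,
          λ u v → ⇔-trans (via-position u v) (vertex-~⇔WAdj (position u) (position v))
          where
          via-position : ∀ u v → u ~ v ⇔ vertex (position u) ~ vertex (position v)
          via-position u v = mk⇔
            (subst₂ _~_ (sym (vertex∘position u)) (sym (vertex∘position v)))
            (subst₂ _~_ (vertex∘position u) (vertex∘position v))

        order : n G ≡ 2 * m
        order = trans (Fin-↔⇒≡ (↔-trans (↔-sym pairs) ×Bool↔*2)) (ℕ.*-comm m 2)

    wreath : V → ∃ λ m → 3 ≤ m × IsoToWreath G m × n G ≡ 2 * m
    wreath v with m , C ← Walk.cycle (~pivot (degenerate v)) = m , Cycle.3≤m C , isoToWreath , order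
      where open Walk (~pivot (degenerate v))
            open OnCycle C

  degenerate⇒twins : Connected G → Degenerate G ℓ →
                     ∀ v w → Rev {G} ℓ v w → v ≢ w × (∀ x → adj G v x ≡ adj G w x)
  degenerate⇒twins conn degen v w Rvw with refl ← Rev⇒≡rev Rvw =
    nonfixed d , twins d
    where d = degenerate-everywhere conn degen v

  degenerate⇒wreath : Connected G → Degenerate G ℓ →
                      ∃ λ m → 3 ≤ m × IsoToWreath G m × n G ≡ 2 * m
  degenerate⇒wreath conn degen =
    Wreath.wreath conn (degenerate-everywhere conn degen) (proj₁ (degenerate⇒degenerateAt degen))

proposition4p1 : (G : Graph) → Connected G → Tetravalent G →
    (ℓ : Fin (n G) → ℤ) → DistanceMagicLabeling G ℓ → SelfReverse G ℓ →
    Degenerate G ℓ →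
    ((v w : Fin (n G)) → Rev {G} ℓ v w → v ≢ w × ((x : Fin (n G)) → adj G v x ≡ adj G w x))
    × (Σ ℕ λ k → n G ≡ 2 * k)
    × (Σ ℕ λ m → 3 ≤ m × IsoToWreath G m)
proposition4p1 G conn tet ℓ dml sr degen =
  let open DegenerateLabelling G tet dml sr
      (m , 3≤m , iso , order) = degenerate⇒wreath conn degen
  in  degenerate⇒twins conn degen , (m , order) , (m , 3≤m , iso)
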